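{- In the effective topos $\mathbf{Eff}$, every contractible object is uniform and has a global element $1\to X$.
   Context: $\mathbf{Eff}$ is Hyland's effective topos: objects are pairs $(X,\sim)$ with $X$ a set and $[\cdot\sim\cdot]:X\times X\to\mathcal{P}(\omega)$ a partial equivalence relation that is symmetric and transitive with uniform partial recursive realizers; morphisms are (equivalence classes of) $\mathcal{P}(\omega)$-valued functional relations. The constant objects functor $\nabla:\mathbf{Set}\to\mathbf{Eff}$ sends $X$ to $(X,\sim)$ with $[x\sim x']=\omega$ if $x=x'$ and $\emptyset$ otherwise. An object is uniform if there is an epimorphism $\nabla Y\to X$ for some set $Y$. In $\mathbf{Eff}$ take the interval $\mathbb{I}=\nabla\{0,1\}$ and the cofibrations to be all monomorphisms; a trivial fibration is a map with the right lifting property against all monomorphisms, and an object $X$ is contractible if $X\to 1$ is a trivial fibration (i.e. $X$ is injective). -}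

module Defs where

open import Data.Nat using (ℕ; zero; suc; _<_)
open import Data.Nat.DivMod using (_%_; _/_)
open import Data.Product using (Σ; _×_; _,_; proj₁; proj₂)
open import Data.Unit using (⊤; tt)
open import Relation.Binary.PropositionalEquality using (_≡_)

-- Cantor pairing, given by its inverse: enumeration of ℕ × ℕ along
-- diagonals (0,0),(1,0),(0,1),(2,0),(1,1),(0,2),…  (a bijection ℕ ≅ ℕ×ℕ)
unpair : ℕ → ℕ × ℕ
unpair zero = 0 , 0
unpair (suc n) with unpair n
... | zero  , b = suc b , 0
... | suc a , b = a , suc b

π₁ π₂ : ℕ → ℕ
π₁ n = proj₁ (unpair n)
π₂ n = proj₂ (unpair n)

-- Unary μ-recursive programs (multiple arguments coded by pairing).
data Prog : Set where
  zero' succ' fst' snd' : Prog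
  pair' : Prog → Prog → Prog   -- x ↦ ⟨f x , g x⟩
  comp' : Prog → Prog → Prog   -- comp' f g = f ∘ g
  rec'  : Prog → Prog → Prog   -- primitive recursion on the 2nd component
  mu'   : Prog → Prog          -- minimisation on the 2nd component

data Eval : Prog → ℕ → ℕ → Set where
  ev-zero : ∀ n → Eval zero' n 0
  ev-succ : ∀ n → Eval succ' n (suc n)
  ev-fst  : ∀ n → Eval fst' n (π₁ n)
  ev-snd  : ∀ n → Eval snd' n (π₂ n)
  ev-pair : ∀ {f g n a b m} → Eval f n a → Eval g n b → unpair m ≡ (a , b) →
            Eval (pair' f g) n m
  ev-comp : ∀ {f g n a m} → Eval g n a → Eval f a m → Eval (comp' f g) n m
  ev-rec0 : ∀ {f g n a m} → unpair n ≡ (a , 0) → Eval f a m → Eval (rec' f g) n m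
  ev-recS : ∀ {f g n a j n' r y m} → unpair n ≡ (a , suc j) → unpair n' ≡ (a , j) →
            Eval (rec' f g) n' r → unpair y ≡ (n' , r) → Eval g y m →
            Eval (rec' f g) n m
  ev-mu   : ∀ {f a k y} → unpair y ≡ (a , k) → Eval f y 0 →
            (∀ j → j < k → ∀ y' → unpair y' ≡ (a , j) → Σ ℕ λ v → Eval f y' (suc v)) →
            Eval (mu' f) a k

-- Gödel numbering: code e = 8·⟨a,b⟩ + tag.  (First argument is fuel.)
decode : ℕ → ℕ → Prog
decode zero e = zero'
decode (suc k) e = go (e % 8) (π₁ (e / 8)) (π₂ (e / 8))
  where
  go : ℕ → ℕ → ℕ → Prog
  go 0 a b = zero'
  go 1 a b = succ'
  go 2 a b = fst'
  go 3 a b = snd'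
  go 4 a b = pair' (decode k a) (decode k b)
  go 5 a b = comp' (decode k a) (decode k b)
  go 6 a b = rec' (decode k a) (decode k b)
  go _ a b = mu' (decode k a)

_·_↓_ : ℕ → ℕ → ℕ → Set
e · n ↓ m = Eval (decode (suc e) e) n m

-- Realizability notation;  P(ω) is represented by  ℕ → Set

Pω : Set₁
Pω = ℕ → Set

_∧ᵣ_ : Pω → Pω → Pω
(P ∧ᵣ Q) n = P (π₁ n) × Q (π₂ n)

Tracks : ℕ → Pω → Pω → Set
Tracks r P Q = ∀ n → P n → Σ ℕ λ m → (r · n ↓ m) × Q m

record Obj : Set₁ where
  field
    Car : Set
    Eq  : Car → Car → Pω
    sym-r   : Σ ℕ λ s → ∀ x y → Tracks s (Eq x y) (Eq y x)
    trans-r : Σ ℕ λ t → ∀ x y z → Tracks t (Eq x y ∧ᵣ Eq y z) (Eq x z)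
open Obj public

record Hom (X Y : Obj) : Set₁ where
  field
    F : Car X → Car Y → Pω
    strict-r : Σ ℕ λ r → ∀ x y → Tracks r (F x y) (Eq X x x ∧ᵣ Eq Y y y)
    relat-r  : Σ ℕ λ r → ∀ x x' y y' →
                 Tracks r (F x y ∧ᵣ (Eq X x x' ∧ᵣ Eq Y y y')) (F x' y')
    single-r : Σ ℕ λ r → ∀ x y y' → Tracks r (F x y ∧ᵣ F x y') (Eq Y y y')
    total-r  : Σ ℕ λ r → ∀ x → Tracks r (Eq X x x) (λ n → Σ (Car Y) λ y → F x y n)
open Hom public

RelEq : {X Y : Obj} → (Car X → Car Y → Pω) → (Car X → Car Y → Pω) → Set
RelEq {X} {Y} R S =
  (Σ ℕ λ r → ∀ x y → Tracks r (R x y) (S x y)) ×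
  (Σ ℕ λ r → ∀ x y → Tracks r (S x y) (R x y))

-- relational composite  (g ∘ f),  written  f ⨾ g
_⨾_ : {X Y Z : Obj} → Hom X Y → Hom Y Z → Car X → Car Z → Pω
_⨾_ {Y = Y} f g x z n = Σ (Car Y) λ y → F f x y (π₁ n) × F g y z (π₂ n)

_≈_ : {X Y : Obj} → Hom X Y → Hom X Y → Set
_≈_ {X} {Y} f g = RelEq {X} {Y} (F f) (F g)

Mono : {A B : Obj} → Hom A B → Set₁
Mono {A} {B} m = (Z : Obj) (g h : Hom Z A) → RelEq {Z} {B} (g ⨾ m) (h ⨾ m) → g ≈ h

Epi : {A B : Obj} → Hom A B → Set₁
Epi {A} {B} e = (Z : Obj) (g h : Hom B Z) → RelEq {A} {Z} (e ⨾ g) (e ⨾ h) → g ≈ h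

∇ : Set → Obj
∇ Y = record
  { Car = Y ; Eq = λ y y' _ → y ≡ y'
  ; sym-r = 0 , λ { y .y n _≡_.refl → 0 , ev-zero n , _≡_.refl }
  ; trans-r = 0 , λ { y .y .y n (_≡_.refl , _≡_.refl) → 0 , ev-zero n , _≡_.refl } }

𝟙 : Obj
𝟙 = record
  { Car = ⊤ ; Eq = λ _ _ _ → ⊤
  ; sym-r = 0 , λ _ _ n _ → 0 , ev-zero n , tt
  ; trans-r = 0 , λ _ _ _ n _ → 0 , ev-zero n , tt }

TrivialFibration : {X Y : Obj} → Hom X Y → Set₁
TrivialFibration {X} {Y} p =
  (A B : Obj) (m : Hom A B) → Mono m →
  (u : Hom A X) (v : Hom B Y) → RelEq {A} {Y} (m ⨾ v) (u ⨾ p) →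
  Σ (Hom B X) λ l → RelEq {A} {X} (m ⨾ l) (F u) × RelEq {B} {Y} (l ⨾ p) (F v)

-- X contractible: (the unique) map X → 1 is a trivial fibration
Contractible : Obj → Set₁
Contractible X = (t : Hom X 𝟙) → TrivialFibration t

Uniform : Obj → Set₁
Uniform X = Σ Set λ Y → Σ (Hom (∇ Y) X) λ e → Epi e

GlobalElement : Obj → Set₁
GlobalElement X = Hom 𝟙 X

-- A contractible object X of Eff is injective. Extending the empty map along the mono 𝟘 ↪ 𝟙
-- gives a global element. For uniformity, present X as a quotient Ext X ↠ X of the subobject
-- Ext X ↪ ∇|X| cut out by the existence predicate [x ∼ x]: extending the quotient map along
-- this mono gives l : ∇|X| → X, and l is surjective because the quotient map factors through
-- it; internally surjective maps are epi.

module Submission where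

open import Data.Nat
open import Data.Nat.DivMod
open import Data.Nat.Divisibility using (n∣m*n)
open import Data.Nat.Properties
open import Data.Product using (Σ; _×_; _,_; proj₁; proj₂)
open import Data.Unit using (⊤; tt)
open import Data.Empty using (⊥)
open import Relation.Binary.PropositionalEquality
open import Relation.Nullary.Decidable using (from-yes)

open import Defs

triangle : ℕ → ℕ
triangle zero    = zero
triangle (suc n) = suc n + triangle n

⟪_,_⟫ : ℕ → ℕ → ℕ
⟪ a , b ⟫ = triangle (a + b) + b

unpair-suc-inner : ∀ k {a b} → unpair k ≡ (suc a , b) → unpair (suc k) ≡ (a , suc b)
unpair-suc-inner k eq rewrite eq = refl

unpair-suc-edge : ∀ k {b} → unpair k ≡ (0 , b) → unpair (suc k) ≡ (suc b , 0)
unpair-suc-edge k eq rewrite eq = refl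

unpair-diagonal : ∀ d a b → a + b ≡ d → unpair (triangle d + b) ≡ (a , b)
unpair-diagonal d a (suc b) a+b≡d =
  subst (λ k → unpair k ≡ (a , suc b)) (sym (+-suc (triangle d) b))
    (unpair-suc-inner (triangle d + b) (unpair-diagonal d (suc a) b (trans (sym (+-suc a b)) a+b≡d)))
unpair-diagonal zero    zero    zero refl = refl
unpair-diagonal (suc d) (suc a) zero a+0≡d
  rewrite suc-injective (trans (sym (+-identityʳ (suc a))) a+0≡d) =
  subst (λ k → unpair k ≡ (suc d , 0)) (cong suc (trans (+-comm (triangle d) d) (sym (+-identityʳ _))))
    (unpair-suc-edge (triangle d + d) (unpair-diagonal d 0 d refl))

unpair-⟪⟫ : ∀ a b → unpair ⟪ a , b ⟫ ≡ (a , b)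
unpair-⟪⟫ a b = unpair-diagonal (a + b) a b refl

π₁-⟪⟫ : ∀ a b → π₁ ⟪ a , b ⟫ ≡ a
π₁-⟪⟫ a b = cong proj₁ (unpair-⟪⟫ a b)

π₂-⟪⟫ : ∀ a b → π₂ ⟪ a , b ⟫ ≡ b
π₂-⟪⟫ a b = cong proj₂ (unpair-⟪⟫ a b)

n≤triangle : ∀ n → n ≤ triangle n
n≤triangle zero    = z≤n
n≤triangle (suc n) = m≤m+n (suc n) (triangle n)

m≤⟪m,n⟫ : ∀ m n → m ≤ ⟪ m , n ⟫
m≤⟪m,n⟫ m n = ≤-trans (m≤m+n m n) (≤-trans (n≤triangle (m + n)) (m≤m+n _ n))

n≤⟪m,n⟫ : ∀ m n → n ≤ ⟪ m , n ⟫
n≤⟪m,n⟫ m n = ≤-trans (m≤n+m n m) (≤-trans (n≤triangle (m + n)) (m≤m+n _ n))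

code : Prog → ℕ
code zero'       = 0
code succ'       = 1
code fst'        = 2
code snd'        = 3
code (pair' f g) = 4 + ⟪ code f , code g ⟫ * 8
code (comp' f g) = 5 + ⟪ code f , code g ⟫ * 8
code (rec' f g)  = 6 + ⟪ code f , code g ⟫ * 8
code (mu' f)     = 7 + ⟪ code f , 0 ⟫ * 8

[t+c*8]%8≡t : ∀ {t} c → t < 8 → (t + c * 8) % 8 ≡ t
[t+c*8]%8≡t {t} c t<8 = trans ([m+kn]%n≡m%n t c 8) (m<n⇒m%n≡m t<8)

[t+c*8]/8≡c : ∀ {t} c → t < 8 → (t + c * 8) / 8 ≡ c
[t+c*8]/8≡c {t} c t<8 = begin
  (t + c * 8) / 8   ≡⟨ +-distrib-/-∣ʳ t (n∣m*n c) ⟩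
  t / 8 + c * 8 / 8 ≡⟨ cong₂ _+_ (m<n⇒m/n≡0 t<8) (m*n/n≡m c 8) ⟩
  c                 ∎
  where open ≡-Reasoning

components< : ∀ t a b {k} → 0 < t → t + ⟪ a , b ⟫ * 8 < suc k → a < k × b < k
components< t a b {k} 0<t lt = ≤-<-trans (m≤⟪m,n⟫ a b) ⟪a,b⟫<k , ≤-<-trans (n≤⟪m,n⟫ a b) ⟪a,b⟫<k
  where
  ⟪a,b⟫<k : ⟪ a , b ⟫ < k
  ⟪a,b⟫<k = ≤-trans (+-mono-≤ 0<t (m≤m*n ⟪ a , b ⟫ 8)) (s≤s⁻¹ lt)

decode-code : ∀ p k → code p < k → decode k (code p) ≡ p
decode-code zero'       (suc k) _ = refl
decode-code succ'       (suc k) _ = refl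
decode-code fst'        (suc k) _ = refl
decode-code snd'        (suc k) _ = refl
decode-code (pair' f g) (suc k) lt
  rewrite [t+c*8]%8≡t ⟪ code f , code g ⟫ (from-yes (4 <? 8))
        | [t+c*8]/8≡c ⟪ code f , code g ⟫ (from-yes (4 <? 8))
        | π₁-⟪⟫ (code f) (code g) | π₂-⟪⟫ (code f) (code g)
  = cong₂ pair' (decode-code f k (proj₁ sub<)) (decode-code g k (proj₂ sub<))
  where
  sub< : code f < k × code g < k
  sub< = components< 4 (code f) (code g) (s≤s z≤n) lt
decode-code (comp' f g) (suc k) lt
  rewrite [t+c*8]%8≡t ⟪ code f , code g ⟫ (from-yes (5 <? 8))
        | [t+c*8]/8≡c ⟪ code f , code g ⟫ (from-yes (5 <? 8))
        | π₁-⟪⟫ (code f) (code g) | π₂-⟪⟫ (code f) (code g)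
  = cong₂ comp' (decode-code f k (proj₁ sub<)) (decode-code g k (proj₂ sub<))
  where
  sub< : code f < k × code g < k
  sub< = components< 5 (code f) (code g) (s≤s z≤n) lt
decode-code (rec' f g) (suc k) lt
  rewrite [t+c*8]%8≡t ⟪ code f , code g ⟫ (from-yes (6 <? 8))
        | [t+c*8]/8≡c ⟪ code f , code g ⟫ (from-yes (6 <? 8))
        | π₁-⟪⟫ (code f) (code g) | π₂-⟪⟫ (code f) (code g)
  = cong₂ rec' (decode-code f k (proj₁ sub<)) (decode-code g k (proj₂ sub<))
  where
  sub< : code f < k × code g < k
  sub< = components< 6 (code f) (code g) (s≤s z≤n) lt
decode-code (mu' f) (suc k) lt
  rewrite [t+c*8]%8≡t ⟪ code f , 0 ⟫ (from-yes (7 <? 8))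
        | [t+c*8]/8≡c ⟪ code f , 0 ⟫ (from-yes (7 <? 8))
        | π₁-⟪⟫ (code f) 0
  = cong mu' (decode-code f k (proj₁ (components< 7 (code f) 0 (s≤s z≤n) lt)))

program : ℕ → Prog
program e = decode (suc e) e

code-realizes : ∀ p {n m} → Eval p n m → code p · n ↓ m
code-realizes p {n} {m} = subst (λ q → Eval q n m) (sym (decode-code p (suc (code p)) ≤-refl))

-- Unfolding these codes during unification would compute astronomically large numerals.
opaque
  idᶜ fstᶜ sndᶜ : ℕ
  idᶜ  = code (pair' fst' snd')
  fstᶜ = code fst'
  sndᶜ = code snd'

  infixr 9 _∘ᶜ_
  _∘ᶜ_ : ℕ → ℕ → ℕ
  r ∘ᶜ s = code (comp' (program r) (program s))

  ⟨_,_⟩ᶜ : ℕ → ℕ → ℕ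
  ⟨ r , s ⟩ᶜ = code (pair' (program r) (program s))

  idᶜ-↓ : ∀ n → idᶜ · n ↓ n
  idᶜ-↓ n = code-realizes (pair' fst' snd') (ev-pair (ev-fst n) (ev-snd n) refl)

  fstᶜ-↓ : ∀ n → fstᶜ · n ↓ π₁ n
  fstᶜ-↓ = ev-fst

  sndᶜ-↓ : ∀ n → sndᶜ · n ↓ π₂ n
  sndᶜ-↓ = ev-snd

  ∘ᶜ-↓ : ∀ {r s n a m} → s · n ↓ a → r · a ↓ m → (r ∘ᶜ s) · n ↓ m
  ∘ᶜ-↓ {r} {s} s↓a r↓m = code-realizes (comp' (program r) (program s)) (ev-comp s↓a r↓m)

  ⟨,⟩ᶜ-↓ : ∀ {r s n a b} → r · n ↓ a → s · n ↓ b → ⟨ r , s ⟩ᶜ · n ↓ ⟪ a , b ⟫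
  ⟨,⟩ᶜ-↓ {r} {s} {a = a} {b} r↓a s↓b =
    code-realizes (pair' (program r) (program s)) (ev-pair r↓a s↓b (unpair-⟪⟫ a b))

-- Record wrappers for Tracks, ∧ᵣ and Σ: type formers are injective, so Agda can infer codes
-- and predicates in combinator terms, which it cannot through the reducible originals.
infix 4 _⊩_⇒_
record _⊩_⇒_ (r : ℕ) (P Q : Pω) : Set where
  constructor tracking
  field track : Tracks r P Q
open _⊩_⇒_

infixr 6 _∧_
record _∧_ (P Q : Pω) (n : ℕ) : Set where
  constructor _,_
  field
    fst : P (π₁ n)
    snd : Q (π₂ n)

record ∃ₚ {A : Set} (Q : A → Pω) (n : ℕ) : Set where
  constructor _,_
  field
    witness : A
    proof   : Q witness n

⊩-map : ∀ {r P Q Q'} → (∀ {n} → Q n → Q' n) → r ⊩ P ⇒ Q → r ⊩ P ⇒ Q'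
⊩-map f (tracking tr) = tracking λ n p → let (m , r↓m , q) = tr n p in m , r↓m , f q

⊩-comap : ∀ {r P P' Q} → (∀ {n} → P' n → P n) → r ⊩ P ⇒ Q → r ⊩ P' ⇒ Q
⊩-comap f (tracking tr) = tracking λ n p → tr n (f p)

⊩-cases : ∀ {r P Q} {A : Set} → (∀ {n} → P n → A) → (A → r ⊩ P ⇒ Q) → r ⊩ P ⇒ Q
⊩-cases f h = tracking λ n p → track (h (f p)) n p

⊩-id : ∀ {P} → idᶜ ⊩ P ⇒ P
⊩-id = tracking λ n p → n , idᶜ-↓ n , p

infixr 9 _⊩-∘_
_⊩-∘_ : ∀ {r s P Q R} → r ⊩ Q ⇒ R → s ⊩ P ⇒ Q → r ∘ᶜ s ⊩ P ⇒ R
_⊩-∘_ {r} {s} (tracking tr) (tracking ts) = tracking λ n p →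
  let (a , s↓a , q) = ts n p
      (m , r↓m , x) = tr a q
  in m , ∘ᶜ-↓ s↓a r↓m , x

⊩-⟨_,_⟩ : ∀ {r s P Q R} → r ⊩ P ⇒ Q → s ⊩ P ⇒ R → ⟨ r , s ⟩ᶜ ⊩ P ⇒ Q ∧ R
⊩-⟨_,_⟩ {r} {s} {Q = Q} {R} (tracking tr) (tracking ts) = tracking λ n p →
  let (a , r↓a , q) = tr n p
      (b , s↓b , x) = ts n p
  in ⟪ a , b ⟫
   , ⟨,⟩ᶜ-↓ r↓a s↓b
   , (subst Q (sym (π₁-⟪⟫ a b)) q , subst R (sym (π₂-⟪⟫ a b)) x)

⊩-fst : ∀ {P Q} → fstᶜ ⊩ P ∧ Q ⇒ P
⊩-fst = tracking λ n (p , _) → π₁ n , fstᶜ-↓ n , p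

⊩-snd : ∀ {P Q} → sndᶜ ⊩ P ∧ Q ⇒ Q
⊩-snd = tracking λ n (_ , q) → π₂ n , sndᶜ-↓ n , q

⊩-⊤ : ∀ {P} → 0 ⊩ P ⇒ (λ _ → ⊤)
⊩-⊤ = tracking λ n _ → 0 , ev-zero n , tt

⊩-∃-elim : ∀ {s R} {A : Set} {Q : A → Pω} → (∀ {a} → s ⊩ Q a ⇒ R) → s ⊩ ∃ₚ Q ⇒ R
⊩-∃-elim h = tracking λ n (a , q) → track (h {a}) n q

⊩-∃ : ∀ {r s P R} {A : Set} {Q : A → Pω} →
      r ⊩ P ⇒ ∃ₚ Q → (∀ {a} → s ⊩ P ∧ Q a ⇒ R) → s ∘ᶜ ⟨ idᶜ , r ⟩ᶜ ⊩ P ⇒ R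
⊩-∃ hr hs = tracking (λ n (p , (a , q)) → track (hs {a}) n (p , q)) ⊩-∘ ⊩-⟨ ⊩-id , hr ⟩

module _ (X : Obj) where
  symᶜ transᶜ : ℕ
  symᶜ   = proj₁ (sym-r X)
  transᶜ = proj₁ (trans-r X)

  ∼-sym : ∀ {x y} → symᶜ ⊩ Eq X x y ⇒ Eq X y x
  ∼-sym {x} {y} = tracking (proj₂ (sym-r X) x y)

  ∼-trans : ∀ {x y z} → transᶜ ⊩ Eq X x y ∧ Eq X y z ⇒ Eq X x z
  ∼-trans {x} {y} {z} = tracking λ n (p , q) → proj₂ (trans-r X) x y z n (p , q)

  ∼-reflˡ : ∀ {x y} → transᶜ ∘ᶜ ⟨ idᶜ , symᶜ ⟩ᶜ ⊩ Eq X x y ⇒ Eq X x x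
  ∼-reflˡ = ∼-trans ⊩-∘ ⊩-⟨ ⊩-id , ∼-sym ⟩

  ∼-reflʳ : ∀ {x y} → transᶜ ∘ᶜ ⟨ symᶜ , idᶜ ⟩ᶜ ⊩ Eq X x y ⇒ Eq X y y
  ∼-reflʳ = ∼-trans ⊩-∘ ⊩-⟨ ∼-sym , ⊩-id ⟩

mkHom : {X Y : Obj} (R : Car X → Car Y → Pω) {s r v t : ℕ} →
        (∀ {x y} → s ⊩ R x y ⇒ Eq X x x ∧ Eq Y y y) →
        (∀ {x x' y y'} → r ⊩ R x y ∧ (Eq X x x' ∧ Eq Y y y') ⇒ R x' y') →
        (∀ {x y y'} → v ⊩ R x y ∧ R x y' ⇒ Eq Y y y') →
        (∀ {x} → t ⊩ Eq X x x ⇒ ∃ₚ (R x)) →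
        Hom X Y
mkHom R {s} {r} {v} {t} str rel sv tot = record
  { F        = R
  ; strict-r = s , λ _ _ → track (⊩-map (λ (p , q) → p , q) str)
  ; relat-r  = r , λ _ _ _ _ → track (⊩-comap (λ (p , (q , u)) → p , (q , u)) rel)
  ; single-r = v , λ _ _ _ → track (⊩-comap (λ (p , q) → p , q) sv)
  ; total-r  = t , λ _ → track (⊩-map (λ (a , p) → a , p) tot) }

module _ {X Y : Obj} (f : Hom X Y) where
  strict : ∀ {x y} → proj₁ (strict-r f) ⊩ F f x y ⇒ Eq X x x ∧ Eq Y y y
  strict {x} {y} = ⊩-map (λ (p , q) → p , q) (tracking (proj₂ (strict-r f) x y))

  relational : ∀ {x x' y y'} →
               proj₁ (relat-r f) ⊩ F f x y ∧ (Eq X x x' ∧ Eq Y y y') ⇒ F f x' y'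
  relational {x} {x'} {y} {y'} =
    ⊩-comap (λ (p , (q , u)) → p , (q , u)) (tracking (proj₂ (relat-r f) x x' y y'))

  single-valued : ∀ {x y y'} → proj₁ (single-r f) ⊩ F f x y ∧ F f x y' ⇒ Eq Y y y'
  single-valued {x} {y} {y'} = ⊩-comap (λ (p , q) → p , q) (tracking (proj₂ (single-r f) x y y'))

  total : ∀ {x} → proj₁ (total-r f) ⊩ Eq X x x ⇒ ∃ₚ (F f x)
  total {x} = ⊩-map (λ (a , p) → a , p) (tracking (proj₂ (total-r f) x))

⊩-⨾ : ∀ {X Y Z : Obj} (f : Hom X Y) (g : Hom Y Z) {r P x z} →
      r ⊩ P ⇒ (f ⨾ g) x z → r ⊩ P ⇒ ∃ₚ (λ y → F f x y ∧ F g y z)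
⊩-⨾ f g = ⊩-map λ (y , p , q) → y , (p , q)

infix 4 _⊑_
_⊑_ : {A B : Set} → (A → B → Pω) → (A → B → Pω) → Set
R ⊑ S = Σ ℕ λ r → ∀ {a b} → r ⊩ R a b ⇒ S a b

⊑-from-Tracks : ∀ {A B : Set} {R S : A → B → Pω} →
                (Σ ℕ λ r → ∀ a b → Tracks r (R a b) (S a b)) → R ⊑ S
⊑-from-Tracks (r , h) = r , tracking (h _ _)

⊑-to-Tracks : ∀ {A B : Set} {R S : A → B → Pω} →
              R ⊑ S → Σ ℕ λ r → ∀ a b → Tracks r (R a b) (S a b)
⊑-to-Tracks (r , h) = r , λ _ _ → track h

Surjective : {A B : Obj} → Hom A B → Set
Surjective {A} {B} f = Σ ℕ λ r → ∀ {b} → r ⊩ Eq B b b ⇒ ∃ₚ (λ a → F f a b)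

Injective : {A B : Obj} → Hom A B → Set
Injective {A} {B} f = Σ ℕ λ r → ∀ {a a' b} → r ⊩ F f a b ∧ F f a' b ⇒ Eq A a a'

injective-cancelʳ : ∀ {A B Z : Obj} (m : Hom A B) → Injective m → (g h : Hom Z A) →
                    (g ⨾ m) ⊑ (h ⨾ m) → F g ⊑ F h
injective-cancelʳ m (_ , inj) g h (_ , H) = _ ,
  ⊩-∃ (total m ⊩-∘ ⊩-snd ⊩-∘ strict g)
   (⊩-∃ (⊩-⨾ h m H ⊩-∘ ⊩-map (λ (p , q) → _ , p , q) ⊩-id)
     (relational h ⊩-∘ ⊩-⟨ ⊩-fst ⊩-∘ ⊩-snd
                         , ⊩-⟨ ⊩-fst ⊩-∘ strict h ⊩-∘ ⊩-fst ⊩-∘ ⊩-snd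
                             , inj ⊩-∘ ⊩-⟨ ⊩-snd ⊩-∘ ⊩-snd , ⊩-snd ⊩-∘ ⊩-fst ⟩ ⟩ ⟩))

injective⇒mono : ∀ {A B : Obj} (m : Hom A B) → Injective m → Mono m
injective⇒mono m inj Z g h (g⨾m⊑h⨾m , h⨾m⊑g⨾m) =
  ⊑-to-Tracks (injective-cancelʳ m inj g h (⊑-from-Tracks g⨾m⊑h⨾m)) ,
  ⊑-to-Tracks (injective-cancelʳ m inj h g (⊑-from-Tracks h⨾m⊑g⨾m))

surjective-cancelˡ : ∀ {A B Z : Obj} (e : Hom A B) → Surjective e → (g h : Hom B Z) →
                     (e ⨾ g) ⊑ (e ⨾ h) → F g ⊑ F h
surjective-cancelˡ e (_ , sur) g h (_ , H) = _ ,
  ⊩-∃ (sur ⊩-∘ ⊩-fst ⊩-∘ strict g)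
   (⊩-∃ (⊩-⨾ e h H ⊩-∘ ⊩-map (λ (p , q) → _ , p , q) ⊩-⟨ ⊩-snd , ⊩-fst ⟩)
     (relational h ⊩-∘ ⊩-⟨ ⊩-snd ⊩-∘ ⊩-snd
                         , ⊩-⟨ single-valued e ⊩-∘ ⊩-⟨ ⊩-fst ⊩-∘ ⊩-snd , ⊩-snd ⊩-∘ ⊩-fst ⟩
                             , ⊩-snd ⊩-∘ strict g ⊩-∘ ⊩-fst ⊩-∘ ⊩-fst ⟩ ⟩))

surjective⇒epi : ∀ {A B : Obj} (e : Hom A B) → Surjective e → Epi e
surjective⇒epi e sur Z g h (e⨾g⊑e⨾h , e⨾h⊑e⨾g) =
  ⊑-to-Tracks (surjective-cancelˡ e sur g h (⊑-from-Tracks e⨾g⊑e⨾h)) ,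
  ⊑-to-Tracks (surjective-cancelˡ e sur h g (⊑-from-Tracks e⨾h⊑e⨾g))

surjective-right-factor : ∀ {A B C : Obj} (m : Hom A B) (l : Hom B C) (u : Hom A C) →
                    F u ⊑ (m ⨾ l) → Surjective u → Surjective l
surjective-right-factor m l u (_ , H) (_ , sur) = _ ,
  ⊩-∃-elim (⊩-∃-elim (⊩-map (λ q → _ , q) ⊩-snd) ⊩-∘ ⊩-⨾ m l H) ⊩-∘ sur

! : (X : Obj) → Hom X 𝟙
! X = mkHom (λ x _ → Eq X x x)
  ⊩-⟨ ⊩-id , ⊩-⊤ ⟩
  (∼-reflʳ X ⊩-∘ ⊩-fst ⊩-∘ ⊩-snd)
  ⊩-⊤
  (⊩-map (λ e → tt , e) ⊩-id)

∇-sub : {Y : Set} → (Y → Pω) → Obj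
∇-sub {Y} φ = record
  { Car     = Y
  ; Eq      = λ y y' n → (y ≡ y') × φ y n
  ; sym-r   = idᶜ  , λ { y .y n (refl , p) → n , idᶜ-↓ n , (refl , p) }
  ; trans-r = fstᶜ , λ { y .y .y n ((refl , p) , (refl , _)) → π₁ n , fstᶜ-↓ n , (refl , p) } }

∇-sub↪ : {Y : Set} (φ : Y → Pω) → Hom (∇-sub φ) (∇ Y)
∇-sub↪ φ = mkHom (Eq (∇-sub φ))
  (⊩-map (λ ((_ , p) , _) → (refl , p) , refl) ⊩-⟨ ⊩-id , ⊩-⊤ ⟩)
  (⊩-cases (λ (_ , ((y≡y₁ , _) , _)) → y≡y₁) λ { refl →
     ⊩-cases (λ (_ , (_ , y'≡y₁')) → y'≡y₁') λ { refl → ⊩-fst } })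
  (⊩-cases (λ ((y≡y₁ , _) , (y≡y₂ , _)) → trans (sym y≡y₁) y≡y₂)
     λ y₁≡y₂ → ⊩-map (λ _ → y₁≡y₂) ⊩-⊤)
  (⊩-map (λ p → _ , p) ⊩-id)

∇-sub↪-injective : {Y : Set} (φ : Y → Pω) → Injective (∇-sub↪ φ)
∇-sub↪-injective φ = fstᶜ ,
  ⊩-cases (λ ((a≡b , _) , (a'≡b , _)) → trans a≡b (sym a'≡b))
    λ a≡a' → ⊩-map (λ (_ , p) → a≡a' , p) ⊩-fst

𝟘 : Obj
𝟘 = record { Car = ⊥ ; Eq = λ () ; sym-r = 0 , λ () ; trans-r = 0 , λ () }

¡ : (X : Obj) → Hom 𝟘 X
¡ X = record { F = λ () ; strict-r = 0 , λ () ; relat-r = 0 , λ ()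
             ; single-r = 0 , λ () ; total-r = 0 , λ () }

¡-injective : (X : Obj) → Injective (¡ X)
¡-injective X = 0 , λ { {()} }

Ext : Obj → Obj
Ext X = ∇-sub (λ x → Eq X x x)

Ext↪ : (X : Obj) → Hom (Ext X) (∇ (Car X))
Ext↪ X = ∇-sub↪ (λ x → Eq X x x)

Ext↠ : (X : Obj) → Hom (Ext X) X
Ext↠ X = mkHom (Eq X)
  ⊩-⟨ ⊩-map (refl ,_) (∼-reflˡ X) , ∼-reflʳ X ⟩
  (⊩-cases (λ (_ , ((x≡x' , _) , _)) → x≡x')
     λ { refl → ∼-trans X ⊩-∘ ⊩-⟨ ⊩-fst , ⊩-snd ⊩-∘ ⊩-snd ⟩ })
  (∼-trans X ⊩-∘ ⊩-⟨ ∼-sym X ⊩-∘ ⊩-fst , ⊩-snd ⟩)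
  (⊩-map (λ (_ , e) → _ , e) ⊩-id)

Ext↠-surjective : (X : Obj) → Surjective (Ext↠ X)
Ext↠-surjective X = idᶜ , ⊩-map (λ e → _ , e) ⊩-id

Ext-square : (X : Obj) → RelEq {Ext X} {𝟙} (Ext↪ X ⨾ ! (∇ (Car X))) (Ext↠ X ⨾ ! X)
Ext-square X =
  ⊑-to-Tracks (_ ,
    ⊩-∃-elim (⊩-map (λ (e , e') → _ , e , e') ⊩-⟨ ⊩-map proj₂ ⊩-fst , ⊩-map proj₂ ⊩-fst ⟩)
      ⊩-∘ ⊩-⨾ (Ext↪ X) (! (∇ (Car X))) ⊩-id) ,
  ⊑-to-Tracks (_ ,
    ⊩-∃-elim (⊩-map (λ (e , _) → _ , (refl , e) , refl) ⊩-⟨ ∼-reflˡ X ⊩-∘ ⊩-fst , ⊩-⊤ ⟩)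
      ⊩-∘ ⊩-⨾ (Ext↠ X) (! X) ⊩-id)

contractible⇒global-element : (X : Obj) → Contractible X → GlobalElement X
contractible⇒global-element X contr = proj₁
  (contr (! X) 𝟘 𝟙 (¡ 𝟙) (injective⇒mono (¡ 𝟙) (¡-injective 𝟙)) (¡ X) (! 𝟙) ((0 , λ ()) , (0 , λ ())))

contractible⇒uniform : (X : Obj) → Contractible X → Uniform X
contractible⇒uniform X contr =
  let (l , ↪⨾l≈↠ , _) = contr (! X) (Ext X) (∇ (Car X))
                              (Ext↪ X) (injective⇒mono (Ext↪ X) (∇-sub↪-injective _))
                              (Ext↠ X) (! (∇ (Car X))) (Ext-square X)
      l-surjective = surjective-right-factor (Ext↪ X) l (Ext↠ X)
                       (⊑-from-Tracks (proj₂ ↪⨾l≈↠)) (Ext↠-surjective X)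
  in Car X , l , surjective⇒epi l l-surjective

proposition6p3 : (X : Obj) → Contractible X → Uniform X × GlobalElement X
proposition6p3 X contr = contractible⇒uniform X contr , contractible⇒global-element X contr
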